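{- Let $\Gamma=(V,E)$ be a reduced graph. Then $\mathrm{Aut}^{\pi}(\Gamma)\le\mathrm{Aut}(\Gamma^2)$.
   Context: Graphs are finite, simple, loopless; $N(v)$ is the neighbourhood of $v$; reduced means $N(v)=N(w)\Rightarrow v=w$. $\mathrm{Aut}^{\pi}(\Gamma)$ is the group of bijections $\pi$ of $V$ such that for every $v$ there exists $w$ with $\pi(N(v))=N(w)$. $\Gamma^2$ has vertex set $V$, with $v_1$ adjacent to $v_2$ if and only if there exists $u\in V$ with $(v_1,u),(u,v_2)\in E$; $\mathrm{Aut}(\Gamma^2)$ is the group of permutations of $V$ preserving this adjacency relation. -}

module Defs where

open import Data.Nat using (ℕ)
open import Data.Fin using (Fin)
open import Data.Bool using (Bool; true; false)
open import Data.Product using (Σ; ∃; _×_; _,_)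
open import Relation.Binary.PropositionalEquality using (_≡_)
open import Function.Bundles using (_⇔_; _↔_; Inverse)
open import Relation.Nullary using (¬_)

record Graph (n : ℕ) : Set where
  field
    adj       : Fin n → Fin n → Bool
    symmetric : ∀ u v → adj u v ≡ adj v u
    loopless  : ∀ v → adj v v ≡ false

open Graph public

Edge : ∀ {n} → Graph n → Fin n → Fin n → Set
Edge Γ v u = adj Γ v u ≡ true

_∈N[_]_ : ∀ {n} → Fin n → Graph n → Fin n → Set
u ∈N[ Γ ] v = Edge Γ v u

SameNbhd : ∀ {n} → Graph n → Fin n → Fin n → Set
SameNbhd Γ v w = ∀ u → (u ∈N[ Γ ] v) ⇔ (u ∈N[ Γ ] w)

Reduced : ∀ {n} → Graph n → Set
Reduced Γ = ∀ v w → SameNbhd Γ v w → v ≡ w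

Perm : ℕ → Set
Perm n = Fin n ↔ Fin n

ImageNbhdEq : ∀ {n} → Graph n → Perm n → Fin n → Fin n → Set
ImageNbhdEq Γ π v w =
  ∀ x → (∃ λ u → (u ∈N[ Γ ] v) × Inverse.to π u ≡ x) ⇔ (x ∈N[ Γ ] w)

InAutPi : ∀ {n} → Graph n → Perm n → Set
InAutPi Γ π = ∀ v → ∃ λ w → ImageNbhdEq Γ π v w

SqAdj : ∀ {n} → Graph n → Fin n → Fin n → Set
SqAdj Γ v₁ v₂ = ∃ λ u → Edge Γ v₁ u × Edge Γ u v₂

InAutSq : ∀ {n} → Graph n → Perm n → Set
InAutSq Γ π = ∀ v₁ v₂ → SqAdj Γ v₁ v₂ ⇔ SqAdj Γ (Inverse.to π v₁) (Inverse.to π v₂)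

module Submission where

open import Defs
open import Data.Nat using (ℕ; zero; suc)
open import Data.Nat.Properties using (1+n≰n)
open import Data.Fin using (Fin; punchOut)
open import Data.Fin.Properties using (any?; _≟_; punchOut-injective; injective⇒≤)
open import Data.Product using (∃; _,_; proj₁; proj₂)
open import Relation.Binary.PropositionalEquality using (_≡_; _≢_; refl; sym; trans; subst)
open import Function.Bundles using (_⇔_; Inverse; Injection; mk⇔; Equivalence)
open import Function.Base using (_∘_)
open import Function.Definitions using (Injective)
open import Function.Properties.Inverse using (↔⇒↣)
open import Relation.Nullary using (yes; no; contradiction)

-- The witness w of π ∈ Aut^π(Γ) defines a map f with x ∈ N(v) ⇔ π x ∈ N(f v).
-- Reducedness makes f injective, hence onto since V is finite.  A common
-- neighbour u of v₁, v₂ then yields the common neighbour f u of π v₁, π v₂, and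
-- conversely every common neighbour of π v₁, π v₂ is of the form f u.

Fin-injective⇒onto : ∀ {n} {f : Fin n → Fin n} → Injective _≡_ _≡_ f →
                     ∀ y → ∃ λ x → f x ≡ y
Fin-injective⇒onto {zero}  _ ()
Fin-injective⇒onto {suc m} {f} f-inj y with any? (λ x → f x ≟ y)
... | yes hit = hit
... | no miss = contradiction (injective⇒≤ g-inj) 1+n≰n
  where
  f≢y : ∀ x → y ≢ f x
  f≢y x y≡fx = miss (x , sym y≡fx)

  g : Fin (suc m) → Fin m
  g x = punchOut (f≢y x)

  g-inj : Injective _≡_ _≡_ g
  g-inj {a} {b} = f-inj ∘ punchOut-injective (f≢y a) (f≢y b)

module _ {n : ℕ} (Γ : Graph n) where

  Edge-sym : ∀ {u v} → Edge Γ u v → Edge Γ v u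
  Edge-sym {u} {v} = trans (symmetric Γ v u)

  NbhdMap : (p f : Fin n → Fin n) → Set
  NbhdMap p f = ∀ v x → (x ∈N[ Γ ] v) ⇔ (p x ∈N[ Γ ] f v)

  InAutPi⇒NbhdMap : (π : Perm n) (aut : InAutPi Γ π) →
                    NbhdMap (Inverse.to π) (λ v → proj₁ (aut v))
  InAutPi⇒NbhdMap π aut v x = mk⇔ into out
    where
    image : ImageNbhdEq Γ π v (proj₁ (aut v))
    image = proj₂ (aut v)

    into : x ∈N[ Γ ] v → Inverse.to π x ∈N[ Γ ] proj₁ (aut v)
    into x∈Nv = Equivalence.to (image _) (x , x∈Nv , refl)

    out : Inverse.to π x ∈N[ Γ ] proj₁ (aut v) → x ∈N[ Γ ] v
    out πx∈Nw with Equivalence.from (image _) πx∈Nw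
    ... | u , u∈Nv , πu≡πx
        rewrite Injection.injective (↔⇒↣ π) πu≡πx = u∈Nv

  NbhdMap-injective : ∀ {p f} → Reduced Γ → NbhdMap p f → Injective _≡_ _≡_ f
  NbhdMap-injective {p} {f} reduced nbhd {v} {v′} fv≡fv′ =
    reduced v v′ λ x → mk⇔ (transport fv≡fv′ x) (transport (sym fv≡fv′) x)
    where
    transport : ∀ {w w′} → f w ≡ f w′ → ∀ x → x ∈N[ Γ ] w → x ∈N[ Γ ] w′
    transport {w} {w′} fw≡fw′ x x∈Nw =
      Equivalence.from (nbhd w′ x) (subst (λ z → p x ∈N[ Γ ] z) fw≡fw′ (Equivalence.to (nbhd w x) x∈Nw))

  NbhdMap-preserves-SqAdj : ∀ {p f} → NbhdMap p f →
                            ∀ {v₁ v₂} → SqAdj Γ v₁ v₂ → SqAdj Γ (p v₁) (p v₂)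
  NbhdMap-preserves-SqAdj nbhd {v₁} {v₂} (u , v₁u , uv₂) =
    _ , Edge-sym (Equivalence.to (nbhd u v₁) (Edge-sym v₁u)) , Equivalence.to (nbhd u v₂) uv₂

  NbhdMap-reflects-SqAdj : ∀ {p f} → NbhdMap p f → (∀ w → ∃ λ u → f u ≡ w) →
                           ∀ {v₁ v₂} → SqAdj Γ (p v₁) (p v₂) → SqAdj Γ v₁ v₂
  NbhdMap-reflects-SqAdj nbhd onto {v₁} {v₂} (w , pv₁w , wpv₂) with onto w
  ... | u , refl =
    u , Edge-sym (Equivalence.from (nbhd u v₁) (Edge-sym pv₁w)) , Equivalence.from (nbhd u v₂) wpv₂

theorem3p2 : ∀ {n : ℕ} (Γ : Graph n) → Reduced Γ → (π : Perm n) → InAutPi Γ π → InAutSq Γ π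
theorem3p2 Γ reduced π aut v₁ v₂ =
  mk⇔ (NbhdMap-preserves-SqAdj Γ nbhd) (NbhdMap-reflects-SqAdj Γ nbhd onto)
  where
  nbhd : NbhdMap Γ (Inverse.to π) (λ v → proj₁ (aut v))
  nbhd = InAutPi⇒NbhdMap Γ π aut
  onto : ∀ w → ∃ λ v → proj₁ (aut v) ≡ w
  onto = Fin-injective⇒onto (NbhdMap-injective Γ reduced nbhd)
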